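{- Let $\Gamma$ be a distance-regular graph with diameter $D\ge3$ and valency $k$, and fix a vertex $x$. Let $v$ be a nonzero vector in $E^*_1V$ which is an eigenvector of $E^*_1AE^*_1$, with eigenvalue $\eta$. Then $\widetilde\eta\neq k$.
   Context: $\Gamma=(X,R)$ is a finite connected distance-regular graph with path-length distance $\partial$, diameter $D$, intersection numbers $p^h_{ij}$, valency $k=p^0_{11}$ and $b_1=p^1_{1,2}$. $A$ is the adjacency matrix, $V=\mathbb{C}^X$, and $E^*_1$ is the diagonal matrix with $yy$-entry $1$ if $\partial(x,y)=1$, else $0$. The map $\eta\mapsto\widetilde\eta$ on $\mathbb{C}\cup\{\infty\}$ is: $\widetilde\eta=\infty$ if $\eta=-1$; $\widetilde\eta=-1$ if $\eta=\infty$; $\widetilde\eta=-1-\frac{b_1}{1+\eta}$ otherwise. -}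

module Defs where

open import Level using (Level; _⊔_)
open import Data.Bool using (Bool; true; false; _∧_; _∨_; not; if_then_else_)
open import Data.Nat using (ℕ; zero; suc; _≤_) renaming (_+_ to _+ℕ_)
open import Data.Fin using (Fin; zero; suc; _≟_)
open import Data.List using (List; []; _∷_; _++_; [_])
open import Data.Product using (Σ; ∃; _×_; _,_)
open import Relation.Nullary using (¬_; ⌊_⌋)
open import Relation.Binary.PropositionalEquality using (_≡_)
open import Algebra.Bundles using (CommutativeRing)

anyFin : ∀ {n} → (Fin n → Bool) → Bool
anyFin {zero}  f = false
anyFin {suc n} f = f zero ∨ anyFin (λ z → f (suc z))

count : ∀ {n} → (Fin n → Bool) → ℕ
count {zero}  f = 0
count {suc n} f = (if f zero then 1 else 0) +ℕ count (λ z → f (suc z))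

record Graph (n : ℕ) : Set where
  field
    adj    : Fin n → Fin n → Bool
    symm   : ∀ x y → adj x y ≡ adj y x
    irrefl : ∀ x → adj x x ≡ false

module _ {n : ℕ} (G : Graph n) where
  open Graph G

  reach : ℕ → Fin n → Fin n → Bool
  reach zero    x y = ⌊ x ≟ y ⌋
  reach (suc i) x y = reach i x y ∨ anyFin (λ z → adj x z ∧ reach i z y)

  isDist : ℕ → Fin n → Fin n → Bool
  isDist zero    x y = reach zero x y
  isDist (suc i) x y = reach (suc i) x y ∧ not (reach i x y)

  Connected : Set
  Connected = ∀ x y → ∃ λ i → isDist i x y ≡ true

  HasDiameter : ℕ → Set
  HasDiameter D = (∀ x y i → isDist i x y ≡ true → i ≤ D)
                × ∃ λ x → ∃ λ y → isDist D x y ≡ true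

  IntersectionNumbers : (ℕ → ℕ → ℕ → ℕ) → Set
  IntersectionNumbers p = ∀ h i j x y → isDist h x y ≡ true →
    count (λ z → isDist i x z ∧ isDist j y z) ≡ p h i j

  IsDRG : (ℕ → ℕ → ℕ → ℕ) → Set
  IsDRG p = Connected × IntersectionNumbers p

-- Scalars: algebraically closed fields of characteristic zero
-- (the field ℂ of the paper is one such)

module FieldNotions {c ℓ : Level} (F : CommutativeRing c ℓ) where
  open CommutativeRing F using (Carrier; _≈_; _+_; _*_; -_; _-_; 0#; 1#)

  fromℕ : ℕ → Carrier
  fromℕ zero    = 0#
  fromℕ (suc m) = 1# + fromℕ m

  IsField : Set (c ⊔ ℓ)
  IsField = ¬ (1# ≈ 0#) × (∀ x → ¬ (x ≈ 0#) → ∃ λ y → x * y ≈ 1#)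

  CharZero : Set ℓ
  CharZero = ∀ m → ¬ (fromℕ (suc m) ≈ 0#)

  -- evaluation of c₀ + c₁ t + … (coefficients lowest degree first)
  evalPoly : List Carrier → Carrier → Carrier
  evalPoly []       t = 0#
  evalPoly (a ∷ as) t = a + t * evalPoly as t

  -- every monic polynomial of degree ≥ 1 has a root
  AlgClosed : Set (c ⊔ ℓ)
  AlgClosed = ∀ (a : Carrier) (as : List Carrier) →
    ∃ λ r → evalPoly (a ∷ as ++ [ 1# ]) r ≈ 0#

  indicator : Bool → Carrier
  indicator true  = 1#
  indicator false = 0#

  sumFin : ∀ {n} → (Fin n → Carrier) → Carrier
  sumFin {zero}  f = 0#
  sumFin {suc n} f = f zero + sumFin (λ z → f (suc z))

  -- Tilde b₁ η t : the value η̃ (with parameter b₁) is the finite scalar t,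
  -- i.e. η ≠ -1 and t = -1 - b₁/(1+η).  (If η = -1 then η̃ = ∞, which is
  -- not a finite scalar.)
  Tilde : ℕ → Carrier → Carrier → Set (c ⊔ ℓ)
  Tilde b₁ η t = ¬ (η ≈ - 1#) ×
    (∃ λ w → (w * (1# + η) ≈ 1#) × (t ≈ (- 1#) - fromℕ b₁ * w))

  module _ {n : ℕ} (G : Graph n) (x : Fin n) where
    open Graph G

    -- diagonal entry of E*_1 (w.r.t. base vertex x) at y
    E1 : Fin n → Carrier
    E1 y = indicator (isDist G 1 x y)

    InE1V : (Fin n → Carrier) → Set ℓ
    InE1V v = ∀ y → isDist G 1 x y ≡ false → v y ≈ 0#

    E1AE1 : (Fin n → Carrier) → Fin n → Carrier
    E1AE1 v y = E1 y * sumFin (λ z → indicator (adj y z) * (E1 z * v z))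

{-# OPTIONS --safe #-}
-- If η̃ = k then (k+1)(1+η) = -b₁, so η = -(k+1+b₁)/(k+1) is a rational eigenvalue of the
-- 0/1-matrix E*₁AE*₁. A rational eigenvalue a/m of an integer matrix C is an integer: if a
-- prime q divides m but not a, then aI - mC has trivial kernel, since eliminating the first
-- column preserves the shape uI + cC with q ∤ u and q ∣ c (its determinant is uⁿ mod q); so
-- every prime factor of m cancels from a/m. Hence (k+1) ∣ b₁. An edge exists, so b₁ ≤ k,
-- forcing b₁ = 0 and η̃ = -1 ≠ k.
module Submission where

open import Defs
open import Level using (Level)
open import Data.Nat using (ℕ; _≤_)
open import Data.Fin using (Fin)
open import Data.Product using (∃; _×_)
open import Relation.Nullary using (¬_)
open import Algebra.Bundles using (CommutativeRing)

open import Data.Bool using (Bool; true; false; _∧_; _∨_; not)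
open import Data.Bool.Properties using (∧-conicalˡ; ∧-idem; ∧-identityʳ)
open import Data.Nat as ℕ using (zero; suc; _<_; z≤n; s≤s)
open import Data.Nat.Properties as ℕ using (+-suc; m≤n⇒m≤1+n)
import Data.Nat.Divisibility as ℕ
open import Data.Nat.Induction using (<-rec)
open import Data.Nat.Primality using (Prime; euclidsLemma; prime⇒nonTrivial; prime⇒nonZero)
open import Data.Nat.Primality.Factorisation using (factorise)
open import Data.Nat.ListAction using (product)
open import Data.List using ([]; _∷_)
open import Data.List.Relation.Unary.All using (_∷_)
open import Data.Integer as ℤ using (ℤ; +_; -[1+_]; 0ℤ; 1ℤ; _⊖_; sign; _◃_)
open import Data.Integer.Properties as ℤ using ([1+m]⊖[1+n]≡m⊖n; abs-*; pos-*; ∣-i∣≡∣i∣)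
open import Data.Integer.Divisibility.Signed
  using (_∣_; divides; _∣?_; ∣⇒∣ᵤ; ∣ᵤ⇒∣; ∣m⇒∣-m; ∣m⇒∣m*n; ∣m+n∣n⇒∣m; *-monoˡ-∣)
open import Data.Sign as Sign using (Sign)
open import Data.Sum using (_⊎_; inj₁; inj₂; [_,_])
open import Data.Maybe using (Maybe; just; nothing)
open import Data.Fin using (zero; suc; _≟_)
open import Data.Vec.Functional using (Vector; tail)
open import Data.Product using (∃-syntax; _,_; proj₂)
open import Data.Empty using (⊥-elim)
open import Function using (_∘_)
import Algebra.Solver.Ring.AlmostCommutativeRing as ACR
open import Relation.Nullary using (yes; no; contradiction)
open import Relation.Nullary.Decidable using (isYes≗does; dec-true)
open import Relation.Binary.PropositionalEquality as ≡ using (_≡_)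

∃-prime-divisor : ∀ k → ∃[ p ] Prime p × p ℕ.∣ suc (suc k)
∃-prime-divisor k with factorise (suc (suc k))
... | record { factors = [] ; isFactorisation = () }
... | record { factors = p ∷ ps ; isFactorisation = eq ; factorsPrime = p-prime ∷ _ } =
  p , p-prime , ℕ.divides (product ps) (≡.trans eq (ℕ.*-comm p (product ps)))

euclidsLemmaℤ : ∀ i j {p} → Prime p → + p ∣ i ℤ.* j → + p ∣ i ⊎ + p ∣ j
euclidsLemmaℤ i j p-prime p∣ij
  with euclidsLemma ℤ.∣ i ∣ ℤ.∣ j ∣ p-prime (≡.subst (_ ℕ.∣_) (abs-* i j) (∣⇒∣ᵤ p∣ij))
... | inj₁ p∣i = inj₁ (∣ᵤ⇒∣ p∣i)
... | inj₂ p∣j = inj₂ (∣ᵤ⇒∣ p∣j)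

m∣n∧n<m⇒n≡0 : ∀ {m n} → m ℕ.∣ n → n < m → n ≡ 0
m∣n∧n<m⇒n≡0 {n = zero}  _   _   = ≡.refl
m∣n∧n<m⇒n≡0 {n = suc n} m∣n n<m = contradiction m∣n (ℕ.>⇒∤ n<m)

anyFin-witness : ∀ {m} (f : Fin m → Bool) → anyFin f ≡ true → ∃ λ z → f z ≡ true
anyFin-witness {zero}  f ()
anyFin-witness {suc m} f any≡true with f zero in f₀≡true
... | true  = zero , f₀≡true
... | false with z , fz≡true ← anyFin-witness (f ∘ suc) any≡true = suc z , fz≡true

anyFin-intro : ∀ {m} (f : Fin m → Bool) z → f z ≡ true → anyFin f ≡ true
anyFin-intro f zero    fz≡true rewrite fz≡true = ≡.refl
anyFin-intro f (suc z) fz≡true with f zero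
... | true  = ≡.refl
... | false = anyFin-intro (f ∘ suc) z fz≡true

count-mono : ∀ {m} {f g : Fin m → Bool} → (∀ z → f z ≡ true → g z ≡ true) → count f ≤ count g
count-mono {zero}          _   = z≤n
count-mono {suc m} {f} {g} f⇒g with f zero in f₀ | g zero in g₀
... | true  | true  = s≤s (count-mono (f⇒g ∘ suc))
... | true  | false with () ← ≡.trans (≡.sym (f⇒g zero f₀)) g₀
... | false | true  = m≤n⇒m≤1+n (count-mono (f⇒g ∘ suc))
... | false | false = count-mono (f⇒g ∘ suc)

[a∨b]∧not[a]⇒b : ∀ a b → (a ∨ b) ∧ not a ≡ true → b ≡ true
[a∨b]∧not[a]⇒b false b e = ≡.trans (≡.sym (∧-identityʳ b)) e

module _ {n : ℕ} (G : Graph n) where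
  open Graph G

  isDist0-refl : ∀ x → isDist G 0 x x ≡ true
  isDist0-refl x = ≡.trans (isYes≗does (x ≟ x)) (dec-true (x ≟ x) ≡.refl)

  adj⇒isDist1 : ∀ {x z} → adj x z ≡ true → isDist G 1 x z ≡ true
  adj⇒isDist1 {x} {z} xz with x ≟ z
  ... | yes ≡.refl with () ← ≡.trans (≡.sym xz) (irrefl x)
  ... | no _ = ≡.trans (∧-identityʳ _) (anyFin-intro _ z (≡.cong₂ _∧_ xz (isDist0-refl z)))

  HasDiameter-suc⇒edge : ∀ {D} → HasDiameter G (suc D) → ∃ λ x → ∃ λ z → adj x z ≡ true
  HasDiameter-suc⇒edge {D} (_ , x , y , far)
    with z , step ← anyFin-witness _ ([a∨b]∧not[a]⇒b (reach G D x y) _ far) = x , z , ∧-conicalˡ _ _ step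

  b₁≤k : ∀ {p D} → IntersectionNumbers G p → HasDiameter G (suc D) → p 1 1 2 ≤ p 0 1 1
  b₁≤k intersection diameter with x , z , xz ← HasDiameter-suc⇒edge diameter =
    ≡.subst₂ _≤_ (intersection 1 1 2 x z (adj⇒isDist1 xz)) (intersection 0 1 1 x x (isDist0-refl x))
      (count-mono {f = λ w → isDist G 1 x w ∧ isDist G 2 z w} {g = λ w → isDist G 1 x w ∧ isDist G 1 x w}
        λ w h → ≡.trans (∧-idem _) (∧-conicalˡ (isDist G 1 x w) (isDist G 2 z w) h))

module IntegerImage {c ℓ : Level} (F : CommutativeRing c ℓ) where
  open CommutativeRing F hiding (zero)
  open FieldNotions F
  open import Algebra.Properties.Ring ring
    using (-0#≈0#; -‿involutive; -‿injective; -‿+-comm; -‿distribˡ-*; -‿distribʳ-*)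
  open import Algebra.Properties.CommutativeSemigroup +-commutativeSemigroup using (interchange)
  open import Algebra.Properties.Semiring.Mult semiring using (×-homo-+; ×1-homo-*) renaming (_×_ to _×ᴿ_)
  open import Relation.Binary.Reasoning.Setoid setoid

  fromℕ≡×ᴿ1# : ∀ m → fromℕ m ≡ m ×ᴿ 1#
  fromℕ≡×ᴿ1# zero    = ≡.refl
  fromℕ≡×ᴿ1# (suc m) = ≡.cong (_+_ 1#) (fromℕ≡×ᴿ1# m)

  fromℕ-+ : ∀ m n → fromℕ (m ℕ.+ n) ≈ fromℕ m + fromℕ n
  fromℕ-+ m n rewrite fromℕ≡×ᴿ1# (m ℕ.+ n) | fromℕ≡×ᴿ1# m | fromℕ≡×ᴿ1# n = ×-homo-+ 1# m n

  fromℕ-* : ∀ m n → fromℕ (m ℕ.* n) ≈ fromℕ m * fromℕ n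
  fromℕ-* m n rewrite fromℕ≡×ᴿ1# (m ℕ.* n) | fromℕ≡×ᴿ1# m | fromℕ≡×ᴿ1# n = ×1-homo-* m n

  signed : Sign → Carrier → Carrier
  signed Sign.+ x = x
  signed Sign.- x = - x

  signed-cong : ∀ s {x y} → x ≈ y → signed s x ≈ signed s y
  signed-cong Sign.+ x≈y = x≈y
  signed-cong Sign.- x≈y = -‿cong x≈y

  signed-* : ∀ s t x y → signed (s Sign.* t) (x * y) ≈ signed s x * signed t y
  signed-* Sign.+ Sign.+ x y = refl
  signed-* Sign.+ Sign.- x y = -‿distribʳ-* x y
  signed-* Sign.- Sign.+ x y = -‿distribˡ-* x y
  signed-* Sign.- Sign.- x y = begin
    x * y         ≈⟨ -‿involutive (x * y) ⟨
    - - (x * y)   ≈⟨ -‿cong (-‿distribʳ-* x y) ⟩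
    - (x * - y)   ≈⟨ -‿distribˡ-* x (- y) ⟩
    - x * - y     ∎

  fromℤ : ℤ → Carrier
  fromℤ i = signed (sign i) (fromℕ ℤ.∣ i ∣)

  fromℤ-◃ : ∀ s n → fromℤ (s ◃ n) ≈ signed s (fromℕ n)
  fromℤ-◃ Sign.+ zero    = refl
  fromℤ-◃ Sign.- zero    = sym -0#≈0#
  fromℤ-◃ Sign.+ (suc n) = refl
  fromℤ-◃ Sign.- (suc n) = refl

  fromℤ-⊖ : ∀ m n → fromℤ (m ⊖ n) ≈ fromℕ m - fromℕ n
  fromℤ-⊖ zero    zero    = sym (-‿inverseʳ 0#)
  fromℤ-⊖ zero    (suc n) = sym (+-identityˡ _)
  fromℤ-⊖ (suc m) zero    = sym (trans (+-congˡ -0#≈0#) (+-identityʳ _))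
  fromℤ-⊖ (suc m) (suc n) = begin
    fromℤ (suc m ⊖ suc n)              ≡⟨ ≡.cong fromℤ ([1+m]⊖[1+n]≡m⊖n m n) ⟩
    fromℤ (m ⊖ n)                      ≈⟨ fromℤ-⊖ m n ⟩
    fromℕ m - fromℕ n                  ≈⟨ +-identityˡ _ ⟨
    0# + (fromℕ m - fromℕ n)           ≈⟨ +-congʳ (-‿inverseʳ 1#) ⟨
    (1# - 1#) + (fromℕ m - fromℕ n)    ≈⟨ interchange 1# (- 1#) (fromℕ m) (- fromℕ n) ⟩
    (1# + fromℕ m) + (- 1# - fromℕ n)  ≈⟨ +-congˡ (-‿+-comm 1# (fromℕ n)) ⟩
    fromℕ (suc m) - fromℕ (suc n)      ∎

  fromℤ-+ : ∀ i j → fromℤ (i ℤ.+ j) ≈ fromℤ i + fromℤ j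
  fromℤ-+ (+ m)    (+ n)    = fromℕ-+ m n
  fromℤ-+ (+ m)    -[1+ n ] = fromℤ-⊖ m (suc n)
  fromℤ-+ -[1+ m ] (+ n)    = trans (fromℤ-⊖ n (suc m)) (+-comm _ _)
  fromℤ-+ -[1+ m ] -[1+ n ] = begin
    - fromℕ (suc (suc (m ℕ.+ n)))        ≡⟨ ≡.cong (λ k → - fromℕ (suc k)) (+-suc m n) ⟨
    - fromℕ (suc m ℕ.+ suc n)            ≈⟨ -‿cong (fromℕ-+ (suc m) (suc n)) ⟩
    - (fromℕ (suc m) + fromℕ (suc n))    ≈⟨ -‿+-comm _ _ ⟨
    - fromℕ (suc m) + - fromℕ (suc n)    ∎

  fromℤ-* : ∀ i j → fromℤ (i ℤ.* j) ≈ fromℤ i * fromℤ j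
  fromℤ-* i j = begin
    fromℤ (s ◃ m ℕ.* n)            ≈⟨ fromℤ-◃ s (m ℕ.* n) ⟩
    signed s (fromℕ (m ℕ.* n))     ≈⟨ signed-cong s (fromℕ-* m n) ⟩
    signed s (fromℕ m * fromℕ n)   ≈⟨ signed-* (sign i) (sign j) (fromℕ m) (fromℕ n) ⟩
    fromℤ i * fromℤ j              ∎
    where
    s = sign i Sign.* sign j
    m = ℤ.∣ i ∣
    n = ℤ.∣ j ∣

  fromℤ-neg : ∀ i → fromℤ (ℤ.- i) ≈ - fromℤ i
  fromℤ-neg -[1+ n ]    = sym (-‿involutive _)
  fromℤ-neg (+ zero)    = sym -0#≈0#
  fromℤ-neg (+ (suc n)) = refl

  fromℤ-homomorphism : ℤ.+-*-rawRing ACR.-Raw-AlmostCommutative⟶ ACR.fromCommutativeRing F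
  fromℤ-homomorphism = record
    { ⟦_⟧    = fromℤ
    ; +-homo = fromℤ-+
    ; *-homo = fromℤ-*
    ; -‿homo = fromℤ-neg
    ; 0-homo = refl
    ; 1-homo = +-identityʳ 1#
    }

  fromℤ-≟ : ∀ i j → Maybe (fromℤ i ≈ fromℤ j)
  fromℤ-≟ i j with i ℤ.≟ j
  ... | yes ≡.refl = just refl
  ... | no _       = nothing

  -- The solver reads con 1ℤ as 1# + 0#, so 1# is passed to it as a variable instead.
  open import Algebra.Solver.Ring ℤ.+-*-rawRing (ACR.fromCommutativeRing F) fromℤ-homomorphism fromℤ-≟ public
    using (solve; _:=_; _:+_; _:*_; :-_; _:-_; con)

  fromℤ≈0⇒≡0 : CharZero → ∀ i → fromℤ i ≈ 0# → i ≡ 0ℤ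
  fromℤ≈0⇒≡0 charZero (+ zero)    _ = ≡.refl
  fromℤ≈0⇒≡0 charZero (+ (suc m)) e = ⊥-elim (charZero m e)
  fromℤ≈0⇒≡0 charZero -[1+ m ]    e = ⊥-elim (charZero m (-‿injective (trans e (sym -0#≈0#))))

module IntegerMatrices {c ℓ : Level} (F : CommutativeRing c ℓ) where
  open CommutativeRing F hiding (zero)
  open FieldNotions F
  open IntegerImage F
  open import Algebra.Properties.Semiring.Sum semiring
    using (sum; sum-cong-≋; ∑-distrib-+; *-distribˡ-sum; sum-replicate-zero)
  open import Relation.Binary.Reasoning.Setoid setoid

  ℤMatrix : ℕ → Set
  ℤMatrix n = Fin n → Fin n → ℤ

  _·ᵥ_ : ∀ {n} → ℤMatrix n → Vector Carrier n → Vector Carrier n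
  (C ·ᵥ v) i = sum λ j → fromℤ (C i j) * v j

  sum-linear : ∀ {n} a b (f g : Vector Carrier n) →
    sum (λ j → a * f j + b * g j) ≈ a * sum f + b * sum g
  sum-linear a b f g = begin
    sum (λ j → a * f j + b * g j)               ≈⟨ ∑-distrib-+ (λ j → a * f j) (λ j → b * g j) ⟩
    sum (λ j → a * f j) + sum (λ j → b * g j)   ≈⟨ +-cong (*-distribˡ-sum a f) (*-distribˡ-sum b g) ⟨
    a * sum f + b * sum g                       ∎

  module FirstColumnElimination {n} (C : ℤMatrix (suc n)) (u c : ℤ) (v : Vector Carrier (suc n))
    (rows : ∀ i → fromℤ u * v i + fromℤ c * (C ·ᵥ v) i ≈ 0#) where

    pivot : ℤ
    pivot = u ℤ.+ c ℤ.* C zero zero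

    schur : ℤMatrix n
    schur i j = pivot ℤ.* C (suc i) (suc j) ℤ.- c ℤ.* (C (suc i) zero ℤ.* C zero (suc j))

    minor : ℤMatrix n
    minor i j = C (suc i) (suc j)

    firstRow : Vector Carrier n
    firstRow j = fromℤ (C zero (suc j)) * v (suc j)

    firstRowTail : Carrier
    firstRowTail = sum firstRow

    private
      U = fromℤ u
      γ = fromℤ c
      P = fromℤ pivot

    pivot-row : P * v zero + γ * firstRowTail ≈ 0#
    pivot-row = begin
      P * v zero + γ * firstRowTail
        ≈⟨ +-congʳ (*-congʳ (trans (fromℤ-+ u _) (+-congˡ (fromℤ-* c _)))) ⟩
      (U + γ * a) * v zero + γ * firstRowTail
        ≈⟨ solve 5 (λ U γ a x S → (U :+ γ :* a) :* x :+ γ :* S := U :* x :+ γ :* (a :* x :+ S))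
                 refl U γ a (v zero) firstRowTail ⟩
      U * v zero + γ * (C ·ᵥ v) zero
        ≈⟨ rows zero ⟩
      0# ∎
      where a = fromℤ (C zero zero)

    schur-expansion : ∀ i → (schur ·ᵥ tail v) i ≈
      P * (minor ·ᵥ tail v) i + (- (γ * fromℤ (C (suc i) zero))) * firstRowTail
    schur-expansion i = trans (sum-cong-≋ entry) (sum-linear P (- (γ * κ)) minorRow firstRow)
      where
      κ = fromℤ (C (suc i) zero)

      minorRow : Vector Carrier n
      minorRow j = fromℤ (minor i j) * v (suc j)

      entry : ∀ j → fromℤ (schur i j) * v (suc j) ≈ P * minorRow j + (- (γ * κ)) * firstRow j
      entry j = begin
        fromℤ (pivot ℤ.* d′ ℤ.- c ℤ.* (κ′ ℤ.* r′)) * w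
          ≈⟨ *-congʳ (trans (fromℤ-+ (pivot ℤ.* d′) _) (+-cong (fromℤ-* pivot d′)
               (trans (fromℤ-neg (c ℤ.* (κ′ ℤ.* r′)))
                 (-‿cong (trans (fromℤ-* c _) (*-congˡ (fromℤ-* κ′ r′))))))) ⟩
        (P * d + - (γ * (κ * r))) * w
          ≈⟨ solve 6 (λ P d γ κ r w → (P :* d :+ :- (γ :* (κ :* r))) :* w
                                    := P :* (d :* w) :+ (:- (γ :* κ)) :* (r :* w))
                   refl P d γ κ r w ⟩
        P * (d * w) + (- (γ * κ)) * (r * w) ∎
        where
        w  = v (suc j)
        d′ = minor i j
        κ′ = C (suc i) zero
        r′ = C zero (suc j)
        d  = fromℤ d′
        r  = fromℤ r′

    schur-rows : ∀ i → fromℤ (u ℤ.* pivot) * tail v i + γ * (schur ·ᵥ tail v) i ≈ 0#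
    schur-rows i = begin
      fromℤ (u ℤ.* pivot) * w + γ * (schur ·ᵥ tail v) i
        ≈⟨ +-cong (*-congʳ (fromℤ-* u pivot)) (*-congˡ (schur-expansion i)) ⟩
      (U * P) * w + γ * (P * S + (- (γ * κ)) * firstRowTail)
        ≈⟨ solve 8 (λ U P w γ S κ x R → (U :* P) :* w :+ γ :* (P :* S :+ (:- (γ :* κ)) :* R)
                                     := P :* (U :* w :+ γ :* (κ :* x :+ S)) :- (γ :* κ) :* (P :* x :+ γ :* R))
                 refl U P w γ S κ (v zero) firstRowTail ⟩
      P * (U * w + γ * (C ·ᵥ v) (suc i)) - (γ * κ) * (P * v zero + γ * firstRowTail)
        ≈⟨ +-cong (*-congˡ (rows (suc i))) (-‿cong (*-congˡ pivot-row)) ⟩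
      P * 0# - (γ * κ) * 0#
        ≈⟨ solve 2 (λ a b → a :* con 0ℤ :- b :* con 0ℤ := con 0ℤ) refl P (γ * κ) ⟩
      0# ∎
      where
      w = v (suc i)
      κ = fromℤ (C (suc i) zero)
      S = (minor ·ᵥ tail v) i

  module _ (isField : IsField) (charZero : CharZero) where

    *-cancelˡ : ∀ {x y z} → ¬ (x ≈ 0#) → x * y ≈ x * z → y ≈ z
    *-cancelˡ {x} {y} {z} x≉0 xy≈xz with x′ , xx′≈1 ← proj₂ isField x x≉0 = begin
      y              ≈⟨ *-identityˡ y ⟨
      1# * y         ≈⟨ *-congʳ xx′≈1 ⟨
      (x * x′) * y   ≈⟨ regroup y ⟩
      x′ * (x * y)   ≈⟨ *-congˡ xy≈xz ⟩
      x′ * (x * z)   ≈⟨ regroup z ⟨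
      (x * x′) * z   ≈⟨ *-congʳ xx′≈1 ⟩
      1# * z         ≈⟨ *-identityˡ z ⟩
      z              ∎
      where
      regroup : ∀ a → (x * x′) * a ≈ x′ * (x * a)
      regroup a = trans (*-congʳ (*-comm x x′)) (*-assoc x′ x a)

    fromℕ≉0 : ∀ m → .{{ℕ.NonZero m}} → ¬ (fromℕ m ≈ 0#)
    fromℕ≉0 (suc m) = charZero m

    module _ {q : ℕ} (q-prime : Prime q) where

      [uI+cC]v≈0⇒v≈0 : ∀ {n} (C : ℤMatrix n) {u c} → ¬ (+ q ∣ u) → + q ∣ c → (v : Vector Carrier n) →
        (∀ i → fromℤ u * v i + fromℤ c * (C ·ᵥ v) i ≈ 0#) → ∀ i → v i ≈ 0#
      [uI+cC]v≈0⇒v≈0 {zero}  C q∤u q∣c v rows ()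
      [uI+cC]v≈0⇒v≈0 {suc n} C {u} {c} q∤u q∣c v rows = λ where
          zero    → v₀≈0
          (suc i) → tail≈0 i
        where
        open FirstColumnElimination C u c v rows

        q∤pivot : ¬ (+ q ∣ pivot)
        q∤pivot q∣pivot = q∤u (∣m+n∣n⇒∣m q∣pivot (∣m⇒∣m*n (C zero zero) q∣c))

        pivot≉0 : ¬ (fromℤ pivot ≈ 0#)
        pivot≉0 pivot≈0 =
          q∤pivot (≡.subst (+ q ∣_) (≡.sym (fromℤ≈0⇒≡0 charZero pivot pivot≈0)) (divides 0ℤ ≡.refl))

        tail≈0 : ∀ i → v (suc i) ≈ 0#
        tail≈0 = [uI+cC]v≈0⇒v≈0 schur ([ q∤u , q∤pivot ] ∘ euclidsLemmaℤ u pivot q-prime) q∣c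
                   (tail v) schur-rows

        firstRowTail≈0 : firstRowTail ≈ 0#
        firstRowTail≈0 =
          trans (sum-cong-≋ (λ j → trans (*-congˡ (tail≈0 j)) (zeroʳ _))) (sum-replicate-zero n)

        v₀≈0 : v zero ≈ 0#
        v₀≈0 = *-cancelˡ pivot≉0 (begin
          fromℤ pivot * v zero                       ≈⟨ +-identityʳ _ ⟨
          fromℤ pivot * v zero + 0#                  ≈⟨ +-congˡ (trans (*-congˡ firstRowTail≈0) (zeroʳ _)) ⟨
          fromℤ pivot * v zero + fromℤ c * firstRowTail ≈⟨ pivot-row ⟩
          0#                                         ≈⟨ zeroʳ _ ⟨
          fromℤ pivot * 0#                           ∎)

    module _ {n} (C : ℤMatrix n) (v : Vector Carrier n) {θ} (eigen : ∀ i → (C ·ᵥ v) i ≈ θ * v i) where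

      prime∣m∧∤a⇒v≈0 : ∀ {q m a} → Prime q → q ℕ.∣ m → ¬ (+ q ∣ a) → fromℕ m * θ ≈ fromℤ a → ∀ i → v i ≈ 0#
      prime∣m∧∤a⇒v≈0 {q} {m} {a} q-prime q∣m q∤a mθ≈a =
        [uI+cC]v≈0⇒v≈0 q-prime C q∤a (∣m⇒∣-m {m = + m} (∣ᵤ⇒∣ q∣m)) v rows
        where
        rows : ∀ j → fromℤ a * v j + fromℤ (ℤ.- + m) * (C ·ᵥ v) j ≈ 0#
        rows j = begin
          fromℤ a * v j + fromℤ (ℤ.- + m) * (C ·ᵥ v) j  ≈⟨ +-congˡ (*-cong (fromℤ-neg (+ m)) (eigen j)) ⟩
          fromℤ a * v j + (- fromℕ m) * (θ * v j)
            ≈⟨ solve 4 (λ A x M θ → A :* x :+ (:- M) :* (θ :* x) := A :* x :- (M :* θ) :* x)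
                     refl (fromℤ a) (v j) (fromℕ m) θ ⟩
          fromℤ a * v j - (fromℕ m * θ) * v j           ≈⟨ +-congˡ (-‿cong (*-congʳ mθ≈a)) ⟩
          fromℤ a * v j - fromℤ a * v j                 ≈⟨ -‿inverseʳ _ ⟩
          0#                                            ∎

      m*θ≈a⇒m∣a : (∃ λ i → ¬ (v i ≈ 0#)) → ∀ m a → fromℕ m * θ ≈ fromℤ a → + m ∣ a
      m*θ≈a⇒m∣a (i , vᵢ≉0) = <-rec _ step
        where
        step : ∀ m → (∀ {m′} → m′ < m → ∀ a → fromℕ m′ * θ ≈ fromℤ a → + m′ ∣ a) →
          ∀ a → fromℕ m * θ ≈ fromℤ a → + m ∣ a
        step zero          _   a 0≈a = divides 0ℤ (fromℤ≈0⇒≡0 charZero a (trans (sym 0≈a) (zeroˡ θ)))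
        step (suc zero)    _   a _   = divides a (≡.sym (ℤ.*-identityʳ a))
        step m@(suc (suc k)) rec a mθ≈a with ∃-prime-divisor k
        ... | q , q-prime , q∣m@(ℕ.divides m′ m≡m′q) with + q ∣? a
        ...   | no q∤a = ⊥-elim (vᵢ≉0 (prime∣m∧∤a⇒v≈0 q-prime q∣m q∤a mθ≈a i))
        ...   | yes (divides a′ a≡a′q) =
          ≡.subst₂ _∣_ (≡.sym (≡.trans (≡.cong +_ m≡m′q) (pos-* m′ q))) (≡.sym a≡a′q)
            (*-monoˡ-∣ (+ q) (rec (ℕ.quotient-< q∣m {{prime⇒nonTrivial q-prime}}) a′ m′θ≈a′))
          where
          m′θ≈a′ : fromℕ m′ * θ ≈ fromℤ a′
          m′θ≈a′ = *-cancelˡ (fromℕ≉0 q {{prime⇒nonZero q-prime}}) (begin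
            fromℕ q * (fromℕ m′ * θ)   ≈⟨ trans (*-congʳ (*-comm _ _)) (*-assoc _ _ _) ⟨
            (fromℕ m′ * fromℕ q) * θ   ≈⟨ *-congʳ (fromℕ-* m′ q) ⟨
            fromℕ (m′ ℕ.* q) * θ       ≡⟨ ≡.cong (λ l → fromℕ l * θ) m≡m′q ⟨
            fromℕ m * θ                ≈⟨ mθ≈a ⟩
            fromℤ a                    ≡⟨ ≡.cong fromℤ a≡a′q ⟩
            fromℤ (a′ ℤ.* + q)         ≈⟨ fromℤ-* a′ (+ q) ⟩
            fromℤ a′ * fromℕ q         ≈⟨ *-comm _ _ ⟩
            fromℕ q * fromℤ a′         ∎)

indicatorℤ : Bool → ℤ
indicatorℤ true  = 1ℤ
indicatorℤ false = 0ℤ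

module LocalEigenvalues {c ℓ : Level} (F : CommutativeRing c ℓ) where
  open CommutativeRing F hiding (zero)
  open FieldNotions F
  open IntegerImage F
  open IntegerMatrices F
  open import Algebra.Properties.Semiring.Sum semiring using (sum; sum-cong-≋; *-distribˡ-sum)
  open import Relation.Binary.Reasoning.Setoid setoid

  sumFin≡sum : ∀ {n} (f : Vector Carrier n) → sumFin f ≡ sum f
  sumFin≡sum {zero}  f = ≡.refl
  sumFin≡sum {suc n} f = ≡.cong (_+_ (f zero)) (sumFin≡sum (f ∘ suc))

  fromℤ-indicatorℤ : ∀ b → fromℤ (indicatorℤ b) ≈ indicator b
  fromℤ-indicatorℤ true  = +-identityʳ 1#
  fromℤ-indicatorℤ false = refl

  module _ {n : ℕ} (G : Graph n) (x : Fin n) where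
    open Graph G

    localAdjacency : ℤMatrix n
    localAdjacency y z =
      indicatorℤ (isDist G 1 x y) ℤ.* (indicatorℤ (adj y z) ℤ.* indicatorℤ (isDist G 1 x z))

    E1AE1≈localAdjacency·ᵥ : ∀ v y → E1AE1 G x v y ≈ (localAdjacency ·ᵥ v) y
    E1AE1≈localAdjacency·ᵥ v y = begin
      E1 G x y * sumFin (λ z → indicator (adj y z) * (E1 G x z * v z))
        ≡⟨ ≡.cong (E1 G x y *_) (sumFin≡sum row) ⟩
      E1 G x y * sum (λ z → indicator (adj y z) * (E1 G x z * v z))
        ≈⟨ *-distribˡ-sum (E1 G x y) row ⟩
      sum (λ z → E1 G x y * (indicator (adj y z) * (E1 G x z * v z)))
        ≈⟨ sum-cong-≋ entry ⟨
      (localAdjacency ·ᵥ v) y ∎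
      where
      row : Vector Carrier n
      row z = indicator (adj y z) * (E1 G x z * v z)

      entry : ∀ z → fromℤ (localAdjacency y z) * v z ≈ E1 G x y * row z
      entry z = begin
        fromℤ (indicatorℤ x∼y ℤ.* (indicatorℤ y∼z ℤ.* indicatorℤ x∼z)) * v z
          ≈⟨ *-congʳ (trans (fromℤ-* (indicatorℤ x∼y) _) (*-cong (fromℤ-indicatorℤ x∼y)
               (trans (fromℤ-* (indicatorℤ y∼z) _)
                 (*-cong (fromℤ-indicatorℤ y∼z) (fromℤ-indicatorℤ x∼z))))) ⟩
        (indicator x∼y * (indicator y∼z * indicator x∼z)) * v z
          ≈⟨ trans (*-assoc _ _ _) (*-congˡ (*-assoc _ _ _)) ⟩
        indicator x∼y * (indicator y∼z * (indicator x∼z * v z)) ∎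
        where
        x∼y = isDist G 1 x y
        y∼z = adj y z
        x∼z = isDist G 1 x z

  tilde-equation : ∀ {b η t} → Tilde b η t → (1# + t) * η ≈ - (1# + t + fromℕ b)
  tilde-equation {b} {η} {t} (_ , w , w[1+η]≈1 , t≈) = begin
    (1# + t) * η                        ≈⟨ *-congʳ (+-congˡ t≈) ⟩
    (1# + (- 1# - B * w)) * η
      ≈⟨ solve 4 (λ o B w η → (o :+ (:- o :- B :* w)) :* η := B :* w :* o :- B :* (w :* (o :+ η)))
               refl 1# B w η ⟩
    B * w * 1# - B * (w * (1# + η))     ≈⟨ +-cong (*-identityʳ (B * w)) (-‿cong (*-congˡ w[1+η]≈1)) ⟩
    B * w - B * 1#                      ≈⟨ +-congˡ (-‿cong (*-identityʳ B)) ⟩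
    B * w - B
      ≈⟨ solve 3 (λ o B w → B :* w :- B := :- (o :+ (:- o :- B :* w) :+ B)) refl 1# B w ⟩
    - (1# + (- 1# - B * w) + B)         ≈⟨ -‿cong (+-congʳ (+-congˡ t≈)) ⟨
    - (1# + t + B)                      ∎
    where B = fromℕ b

  tilde-zero : ∀ {η t} → Tilde 0 η t → 1# + t ≈ 0#
  tilde-zero (_ , w , _ , t≈) = trans (+-congˡ t≈)
    (solve 2 (λ o w → o :+ (:- o :- con 0ℤ :* w) := con 0ℤ) refl 1# w)

proposition7p2 :
    ∀ {c ℓ : Level} (F : CommutativeRing c ℓ) →
    let open CommutativeRing F
        open FieldNotions F
    in IsField → CharZero → AlgClosed →
       ∀ {n : ℕ} (G : Graph n) (p : ℕ → ℕ → ℕ → ℕ) (D : ℕ) →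
       IsDRG G p → HasDiameter G D → 3 ≤ D →
       ∀ (x : Fin n) (v : Fin n → Carrier) (η : Carrier) →
       InE1V G x v → (∃ λ y → ¬ (v y ≈ 0#)) →
       (∀ y → E1AE1 G x v y ≈ η * v y) →
       ¬ Tilde (p 1 1 2) η (fromℕ (p 0 1 1))
proposition7p2 F isField charZero _ G p (suc _) (_ , intersection) diameter (s≤s _) x v η _ nonzero eigen tilde =
  charZero k (tilde-zero (≡.subst (λ b → Tilde b η (fromℕ k)) b₁≡0 tilde))
  where
  open CommutativeRing F
  open FieldNotions F
  open IntegerImage F
  open IntegerMatrices F
  open LocalEigenvalues F
  open import Relation.Binary.Reasoning.Setoid setoid

  k  = p 0 1 1
  b₁ = p 1 1 2

  localEigen : ∀ y → (localAdjacency G x ·ᵥ v) y ≈ η * v y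
  localEigen y = trans (sym (E1AE1≈localAdjacency·ᵥ G x v y)) (eigen y)

  k+1∣-[k+1+b₁] : + suc k ∣ ℤ.- + (suc k ℕ.+ b₁)
  k+1∣-[k+1+b₁] = m*θ≈a⇒m∣a isField charZero (localAdjacency G x) v localEigen nonzero (suc k) _ (begin
    fromℕ (suc k) * η                 ≈⟨ tilde-equation {b = b₁} tilde ⟩
    - (fromℕ (suc k) + fromℕ b₁)      ≈⟨ -‿cong (fromℕ-+ (suc k) b₁) ⟨
    - fromℕ (suc k ℕ.+ b₁)            ≈⟨ fromℤ-neg (+ (suc k ℕ.+ b₁)) ⟨
    fromℤ (ℤ.- + (suc k ℕ.+ b₁))      ∎)

  k+1∣k+1+b₁ : suc k ℕ.∣ suc k ℕ.+ b₁
  k+1∣k+1+b₁ = ≡.subst (suc k ℕ.∣_) (∣-i∣≡∣i∣ (+ (suc k ℕ.+ b₁))) (∣⇒∣ᵤ k+1∣-[k+1+b₁])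

  b₁≡0 : b₁ ≡ 0
  b₁≡0 = m∣n∧n<m⇒n≡0 (ℕ.∣m+n∣m⇒∣n k+1∣k+1+b₁ ℕ.∣-refl) (s≤s (b₁≤k G intersection diameter))
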